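{- Let $n\ge 0$ and let $G$ be a self-complementary graph on $4n+1$ vertices. Then $G$ contains a $K_{2n+1}$ minor.
   Context: Graphs are finite, simple and undirected. $cG$ denotes the complement of $G$ (same vertex set, two distinct vertices adjacent in $cG$ iff not adjacent in $G$); $G$ is self-complementary if $G\cong cG$. A minor is obtained by edge deletions, vertex deletions and edge contractions. -}

module Defs where

open import Data.Nat using (ℕ; suc)
open import Data.Fin using (Fin; punchIn)
open import Data.Fin.Properties using (_≟_)
open import Data.Bool using (Bool; true; false; not; _∧_; _∨_; if_then_else_)
open import Data.Bool.Properties using (∨-comm)
open import Relation.Nullary using (yes; no; ¬_)
open import Relation.Nullary.Decidable using (⌊_⌋)
open import Relation.Binary.PropositionalEquality using (_≡_; refl; sym)
open import Function.Bundles using (_↔_; Inverse)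
open import Data.Empty using (⊥-elim)

record Graph (n : ℕ) : Set where
  field
    adj    : Fin n → Fin n → Bool
    adj-sym    : ∀ x y → adj x y ≡ adj y x
    adj-irrefl : ∀ x → adj x x ≡ false
open Graph public

mkGraph : ∀ {n} → (Fin n → Fin n → Bool) → Graph n
mkGraph {n} r = record { adj = a ; adj-sym = s ; adj-irrefl = i }
  where
  a : Fin n → Fin n → Bool
  a x y with x ≟ y
  ... | yes _ = false
  ... | no _  = r x y ∨ r y x
  s : ∀ x y → a x y ≡ a y x
  s x y with x ≟ y | y ≟ x
  ... | yes _ | yes _ = refl
  ... | yes p | no q  = ⊥-elim (q (sym p))
  ... | no q  | yes p = ⊥-elim (q (sym p))
  ... | no _  | no _  = ∨-comm (r x y) (r y x)
  i : ∀ x → a x x ≡ false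
  i x with x ≟ x
  ... | yes _ = refl
  ... | no q  = ⊥-elim (q refl)

complement : ∀ {n} → Graph n → Graph n
complement G = mkGraph (λ x y → not (adj G x y))

complete : (t : ℕ) → Graph t
complete t = mkGraph (λ _ _ → true)

record _≅_ {n : ℕ} (G H : Graph n) : Set where
  field
    bij       : Fin n ↔ Fin n
    preserves : ∀ x y → adj G x y ≡ adj H (Inverse.to bij x) (Inverse.to bij y)

SelfComplementary : ∀ {n} → Graph n → Set
SelfComplementary G = G ≅ complement G

deleteEdge : ∀ {n} → Graph n → Fin n → Fin n → Graph n
deleteEdge G u v =
  mkGraph (λ x y → adj G x y ∧ not ((⌊ x ≟ u ⌋ ∧ ⌊ y ≟ v ⌋) ∨ (⌊ x ≟ v ⌋ ∧ ⌊ y ≟ u ⌋)))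

deleteVertex : ∀ {n} → Graph (suc n) → Fin (suc n) → Graph n
deleteVertex G i = record
  { adj    = λ x y → adj G (punchIn i x) (punchIn i y)
  ; adj-sym    = λ x y → adj-sym G (punchIn i x) (punchIn i y)
  ; adj-irrefl = λ x → adj-irrefl G (punchIn i x)
  }

-- Contraction of the edge {i,j}: vertex i is merged into vertex j
-- (i is removed, and j becomes adjacent to all former neighbours of i).
contract : ∀ {n} → Graph (suc n) → Fin (suc n) → Fin (suc n) → Graph n
contract G i j = mkGraph (λ x y →
  adj G (punchIn i x) (punchIn i y)
  ∨ (⌊ punchIn i x ≟ j ⌋ ∧ adj G i (punchIn i y)))

-- H ≼ G : H is (isomorphic to) a minor of G, i.e. H is obtained from G by a
-- finite sequence of edge deletions, vertex deletions and edge contractions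
-- (followed by an isomorphism).
data _≼_ : ∀ {m k} → Graph m → Graph k → Set where
  ≼-iso   : ∀ {m} {H G : Graph m} → H ≅ G → H ≼ G
  ≼-delE  : ∀ {m k} {H : Graph m} {G : Graph k} (u v : Fin k) →
            H ≼ deleteEdge G u v → H ≼ G
  ≼-delV  : ∀ {m k} {H : Graph m} {G : Graph (suc k)} (i : Fin (suc k)) →
            H ≼ deleteVertex G i → H ≼ G
  ≼-contr : ∀ {m k} {H : Graph m} {G : Graph (suc k)} (i j : Fin (suc k)) →
            ¬ (i ≡ j) → adj G i j ≡ true →
            H ≼ contract G i j → H ≼ G

HasCompleteMinor : ∀ {n} → ℕ → Graph n → Set
HasCompleteMinor t G = complete t ≼ G

module Submission where

-- Let σ : G ≅ cG and call x linked when x ~ σ x. If x ≠ σ x, then σ x ~ σ² x iff x ≁ σ x, so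
-- the vertices split into the pairs {a, σ a} with a linked and the fixed points of σ. Each class
-- is a clique, and two classes with representatives a, b are joined by an edge: if a ≁ b then
-- σ a ~ σ b. Contracting the pairs therefore gives a complete graph, on at least
-- ⌈(4n + 1)/2⌉ = 2n + 1 vertices since every class has at most two elements.

open import Defs
open import Data.Nat using (ℕ; suc; _*_; _≤_; _<_)
open import Data.Nat.Properties using (*-assoc; *-comm; *-cancelˡ-<; m≤n⇒m<n∨m≡n; ≤-pred)
open import Data.Fin using (Fin; zero; punchIn; punchOut)
open import Data.Fin.Properties
  using (_≟_; punchIn-punchOut; punchIn-injective; any?; combine-injective; injective⇒≤; 2↔Bool)
open import Data.Bool using (Bool; true; false; not; _∨_; _∧_; if_then_else_)
open import Data.Bool.Properties using (∨-idem; ∨-zeroʳ; not-involutive; not-injective)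
open import Data.Product using (∃₂; _×_; _,_)
open import Data.Sum using (inj₁; inj₂)
open import Data.Empty using (⊥-elim)
open import Relation.Nullary using (Dec; yes; no)
open import Relation.Nullary.Decidable using (⌊_⌋; isYes≗does; dec-true; ¬?; _×-dec_)
open import Relation.Binary.Definitions using (DecidableEquality)
open import Relation.Binary.PropositionalEquality
  using (_≡_; _≢_; refl; sym; trans; cong; cong₂; subst; subst₂; module ≡-Reasoning)
open import Function using (_∘_)
open import Function.Bundles using (Inverse)
open import Function.Construct.Identity using (↔-id)

IsComplete : ∀ {N} → Graph N → Set
IsComplete {N} G = ∀ (x y : Fin N) → x ≢ y → adj G x y ≡ true

mkGraph-adj : ∀ {N} (r : Fin N → Fin N → Bool) {x y : Fin N} →
              x ≢ y → r x y ≡ true → adj (mkGraph r) x y ≡ true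
mkGraph-adj r {x} {y} x≢y rxy with x ≟ y
... | yes x≡y = ⊥-elim (x≢y x≡y)
... | no _ rewrite rxy = refl

complement-adj : ∀ {N} (G : Graph N) {x y : Fin N} →
                 x ≢ y → adj (complement G) x y ≡ not (adj G x y)
complement-adj G {x} {y} x≢y with x ≟ y
... | yes x≡y = ⊥-elim (x≢y x≡y)
... | no _ rewrite adj-sym G y x = ∨-idem (not (adj G x y))

complete≅ : ∀ {N} (G : Graph N) → IsComplete G → complete N ≅ G
complete≅ {N} G G-complete = record { bij = ↔-id (Fin N) ; preserves = same-adj }
  where
  same-adj : ∀ x y → adj (complete N) x y ≡ adj G x y
  same-adj x y with x ≟ y
  ... | yes refl = sym (adj-irrefl G x)
  ... | no x≢y   = sym (G-complete x y x≢y)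

≼-complete : ∀ {t N} (G : Graph N) → t ≤ N → IsComplete G → complete t ≼ G
≼-complete G t≤N G-complete with m≤n⇒m<n∨m≡n t≤N
... | inj₂ refl = ≼-iso (complete≅ G G-complete)
≼-complete {N = suc N} G _ G-complete | inj₁ t<1+N =
  ≼-delV zero (≼-complete (deleteVertex G zero) (≤-pred t<1+N)
    (λ x y x≢y → G-complete _ _ (x≢y ∘ punchIn-injective zero x y)))

module Contraction {N : ℕ} (G : Graph (suc N)) {i j : Fin (suc N)} (i≢j : i ≢ j) where

  merge : Fin (suc N) → Fin N
  merge x with x ≟ i
  ... | yes _   = punchOut i≢j
  ... | no x≢i  = punchOut (x≢i ∘ sym)

  punchIn-merge-i : punchIn i (merge i) ≡ j
  punchIn-merge-i with i ≟ i
  ... | yes _  = punchIn-punchOut i≢j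
  ... | no i≢i = ⊥-elim (i≢i refl)

  punchIn-merge : ∀ {x} → x ≢ i → punchIn i (merge x) ≡ x
  punchIn-merge {x} x≢i with x ≟ i
  ... | yes x≡i = ⊥-elim (x≢i x≡i)
  ... | no _    = punchIn-punchOut _

  inherits : Fin N → Fin N → Bool
  inherits x y = ⌊ punchIn i x ≟ j ⌋ ∧ adj G i (punchIn i y)

  joined : Fin N → Fin N → Bool
  joined x y = adj G (punchIn i x) (punchIn i y) ∨ inherits x y

  contract-adj : ∀ {p q} → p ≢ q → adj G (punchIn i p) (punchIn i q) ≡ true →
                 adj (contract G i j) p q ≡ true
  contract-adj {p} {q} p≢q a = mkGraph-adj joined p≢q (cong (_∨ inherits p q) a)

  contract-adj-merged : ∀ {p q} → p ≢ q → punchIn i p ≡ j → adj G i (punchIn i q) ≡ true →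
                        adj (contract G i j) p q ≡ true
  contract-adj-merged {p} {q} p≢q p↦j a =
    mkGraph-adj joined p≢q
      (trans (cong₂ (λ b c → adj G (punchIn i p) (punchIn i q) ∨ (b ∧ c))
                    (trans (isYes≗does (punchIn i p ≟ j)) (dec-true (punchIn i p ≟ j) p↦j)) a)
             (∨-zeroʳ (adj G (punchIn i p) (punchIn i q))))

  merge-preserves-adj : ∀ {x y} → adj G x y ≡ true → merge x ≢ merge y →
                        adj (contract G i j) (merge x) (merge y) ≡ true
  merge-preserves-adj {x} {y} a mx≢my = by-cases (x ≟ i) (y ≟ i)
    where
    i-adj : ∀ {z} → z ≢ i → adj G i z ≡ true → adj G i (punchIn i (merge z)) ≡ true
    i-adj z≢i = subst (λ z → adj G i z ≡ true) (sym (punchIn-merge z≢i))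
    by-cases : Dec (x ≡ i) → Dec (y ≡ i) → adj (contract G i j) (merge x) (merge y) ≡ true
    by-cases (yes x≡i) (yes y≡i) = ⊥-elim (mx≢my (cong merge (trans x≡i (sym y≡i))))
    by-cases (yes refl) (no y≢i) = contract-adj-merged mx≢my punchIn-merge-i (i-adj y≢i a)
    by-cases (no x≢i) (yes refl) =
      trans (adj-sym (contract G i j) (merge x) (merge i))
        (contract-adj-merged (mx≢my ∘ sym) punchIn-merge-i (i-adj x≢i (trans (adj-sym G i x) a)))
    by-cases (no x≢i) (no y≢i) =
      contract-adj mx≢my
        (subst₂ (λ p q → adj G p q ≡ true) (sym (punchIn-merge x≢i)) (sym (punchIn-merge y≢i)) a)

module _ {A : Set} {N : ℕ} (G : Graph N) (label : Fin N → A) where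

  LabelClassesAreCliques : Set
  LabelClassesAreCliques = ∀ x y → label x ≡ label y → x ≢ y → adj G x y ≡ true

  LabelClassesAreAdjacent : Set
  LabelClassesAreAdjacent = ∀ x y → label x ≢ label y →
    ∃₂ λ x′ y′ → label x′ ≡ label x × label y′ ≡ label y × adj G x′ y′ ≡ true

-- Constructive form of "label takes at least t values": it factors through no set of fewer than t elements.
AtLeastValues : ∀ {A : Set} {N} → ℕ → (Fin N → A) → Set
AtLeastValues {A} {N} t label =
  ∀ {K} (b : Fin N → Fin K) (h : Fin K → A) → (∀ x → label x ≡ h (b x)) → t ≤ K

adjacent-injective⇒complete : ∀ {A : Set} {N} (G : Graph N) (label : Fin N → A) →
  (∀ x y → label x ≡ label y → x ≡ y) → LabelClassesAreAdjacent G label → IsComplete G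
adjacent-injective⇒complete G label inj touch x y x≢y with touch x y (x≢y ∘ inj x y)
... | x′ , y′ , x′~x , y′~y , a rewrite inj x′ x x′~x | inj y′ y y′~y = a

module ContractLabelClass {A : Set} {N : ℕ} (G : Graph (suc N)) (label : Fin (suc N) → A)
  {i j : Fin (suc N)} (i≢j : i ≢ j) (same : label i ≡ label j) where

  open Contraction G i≢j

  label′ : Fin N → A
  label′ = label ∘ punchIn i

  label′-merge : ∀ x → label′ (merge x) ≡ label x
  label′-merge x = by-cases (x ≟ i)
    where
    by-cases : Dec (x ≡ i) → label′ (merge x) ≡ label x
    by-cases (yes refl) = trans (cong label punchIn-merge-i) (sym same)
    by-cases (no x≢i)   = cong label (punchIn-merge x≢i)

  cliques : LabelClassesAreCliques G label → LabelClassesAreCliques (contract G i j) label′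
  cliques cl x y eq x≢y = contract-adj x≢y (cl _ _ eq (x≢y ∘ punchIn-injective i x y))

  adjacent : LabelClassesAreAdjacent G label → LabelClassesAreAdjacent (contract G i j) label′
  adjacent touch x y ne with touch (punchIn i x) (punchIn i y) ne
  ... | x′ , y′ , x′~x , y′~y , a =
    merge x′ , merge y′ , trans (label′-merge x′) x′~x , trans (label′-merge y′) y′~y ,
    merge-preserves-adj a (λ e → ne (begin
      label′ x           ≡⟨ sym x′~x ⟩
      label x′           ≡⟨ sym (label′-merge x′) ⟩
      label′ (merge x′)  ≡⟨ cong label′ e ⟩
      label′ (merge y′)  ≡⟨ label′-merge y′ ⟩
      label y′           ≡⟨ y′~y ⟩
      label′ y           ∎))
    where open ≡-Reasoning

  atLeast : ∀ {t} → AtLeastValues t label → AtLeastValues t label′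
  atLeast many b h factors = many (b ∘ merge) h (λ x → trans (sym (label′-merge x)) (factors (merge x)))

≼-contractLabelClasses : ∀ {A : Set} → DecidableEquality A → ∀ t {N} (G : Graph N) (label : Fin N → A) →
  LabelClassesAreCliques G label → LabelClassesAreAdjacent G label → AtLeastValues t label →
  complete t ≼ G
≼-contractLabelClasses _≟ᴬ_ t G label cl touch many
  with any? (λ i → any? (λ j → ¬? (i ≟ j) ×-dec (label i ≟ᴬ label j)))
... | no ¬repeated =
  ≼-complete G (many (λ x → x) label (λ _ → refl)) (adjacent-injective⇒complete G label injective touch)
  where
  injective : ∀ x y → label x ≡ label y → x ≡ y
  injective x y eq with x ≟ y
  ... | yes x≡y = x≡y
  ... | no x≢y  = ⊥-elim (¬repeated (x , y , x≢y , eq))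
≼-contractLabelClasses _≟ᴬ_ t {suc N} G label cl touch many | yes (i , j , i≢j , same) =
  ≼-contr i j i≢j (cl i j same i≢j)
    (≼-contractLabelClasses _≟ᴬ_ t (contract G i j) label′ (cliques cl) (adjacent touch) (atLeast many))
  where open ContractLabelClass G label i≢j same

tagged-injective⇒≤ : ∀ {M N k} (b : Fin M → Fin N) (tag : Fin M → Fin k) →
  (∀ {x y} → b x ≡ b y → tag x ≡ tag y → x ≡ y) → M ≤ N * k
tagged-injective⇒≤ b tag injective = injective⇒≤ λ {x} {y} e →
  let (bx≡by , tx≡ty) = combine-injective (b x) (tag x) (b y) (tag y) e in injective bx≡by tx≡ty

module SelfComplementaryPairing {M : ℕ} (G : Graph M) (G≅cG : SelfComplementary G) where

  open _≅_ G≅cG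

  σ σ⁻¹ : Fin M → Fin M
  σ   = Inverse.to bij
  σ⁻¹ = Inverse.from bij

  σσ⁻¹ : ∀ x → σ (σ⁻¹ x) ≡ x
  σσ⁻¹ = Inverse.strictlyInverseˡ bij

  σ⁻¹σ : ∀ x → σ⁻¹ (σ x) ≡ x
  σ⁻¹σ = Inverse.strictlyInverseʳ bij

  σ-injective : ∀ {x y} → σ x ≡ σ y → x ≡ y
  σ-injective {x} {y} e = trans (sym (σ⁻¹σ x)) (trans (cong σ⁻¹ e) (σ⁻¹σ y))

  σ⁻¹-injective : ∀ {x y} → σ⁻¹ x ≡ σ⁻¹ y → x ≡ y
  σ⁻¹-injective {x} {y} e = trans (sym (σσ⁻¹ x)) (trans (cong σ e) (σσ⁻¹ y))

  σ-flips : ∀ {x y} → x ≢ y → adj G (σ x) (σ y) ≡ not (adj G x y)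
  σ-flips {x} {y} x≢y = begin
    adj G (σ x) (σ y)                     ≡⟨ sym (not-involutive _) ⟩
    not (not (adj G (σ x) (σ y)))         ≡⟨ cong not (sym (complement-adj G (x≢y ∘ σ-injective))) ⟩
    not (adj (complement G) (σ x) (σ y))  ≡⟨ cong not (sym (preserves x y)) ⟩
    not (adj G x y)                       ∎
    where open ≡-Reasoning

  linked : Fin M → Bool
  linked x = adj G x (σ x)

  linked⇒≢σ : ∀ {x} → linked x ≡ true → x ≢ σ x
  linked⇒≢σ {x} lx x≡σx with trans (sym lx) (trans (cong (adj G x) (sym x≡σx)) (adj-irrefl G x))
  ... | ()

  -- The pair {a, σ a} with a linked is labelled a; a fixed point of σ labels itself.
  head : Fin M → Fin M
  head x = if linked x then x else σ⁻¹ x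

  head-linked : ∀ {x} → linked x ≡ true → head x ≡ x
  head-linked {x} lx = cong (λ b → if b then x else σ⁻¹ x) lx

  head-unlinked : ∀ {x} → linked x ≡ false → head x ≡ σ⁻¹ x
  head-unlinked {x} ¬lx = cong (λ b → if b then x else σ⁻¹ x) ¬lx

  data Head (a : Fin M) : Set where
    linkedHead : linked a ≡ true → Head a
    fixedHead  : σ a ≡ a → Head a

  head-Head : ∀ x → Head (head x)
  head-Head x = by-cases (linked x) refl
    where
    by-cases : ∀ b → linked x ≡ b → Head (head x)
    by-cases true lx = subst Head (sym (head-linked lx)) (linkedHead lx)
    by-cases false ¬lx with σ⁻¹ x ≟ x
    ... | yes fixed = subst Head (sym (head-unlinked ¬lx)) (fixedHead (trans (σσ⁻¹ x) (sym fixed)))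
    ... | no moved  = subst Head (sym (head-unlinked ¬lx)) (linkedHead (not-injective (begin
      not (linked (σ⁻¹ x))  ≡⟨ sym (σ-flips (λ e → moved (trans e (σσ⁻¹ x)))) ⟩
      linked (σ (σ⁻¹ x))    ≡⟨ cong linked (σσ⁻¹ x) ⟩
      linked x              ≡⟨ ¬lx ⟩
      false                 ∎)))
      where open ≡-Reasoning

  head-fixes-Head : ∀ {a} → Head a → head a ≡ a
  head-fixes-Head (linkedHead la) = head-linked la
  head-fixes-Head {a} (fixedHead σa≡a) = by-cases (linked a) refl
    where
    by-cases : ∀ b → linked a ≡ b → head a ≡ a
    by-cases true la   = head-linked la
    by-cases false ¬la = trans (head-unlinked ¬la) (trans (cong σ⁻¹ (sym σa≡a)) (σ⁻¹σ a))

  head-σ-Head : ∀ {a} → Head a → head (σ a) ≡ a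
  head-σ-Head {a} (linkedHead la) =
    trans (head-unlinked (trans (σ-flips (linked⇒≢σ la)) (cong not la))) (σ⁻¹σ a)
  head-σ-Head {a} (fixedHead σa≡a) = trans (cong head σa≡a) (head-fixes-Head (fixedHead σa≡a))

  head-idem : ∀ x → head (head x) ≡ head x
  head-idem x = head-fixes-Head (head-Head x)

  head-linked-injective : ∀ {u w} → head u ≡ head w → linked u ≡ linked w → u ≡ w
  head-linked-injective {u} {w} eq lu≡lw = by-cases (linked u) refl
    where
    by-cases : ∀ b → linked u ≡ b → u ≡ w
    by-cases true lu = trans (sym (head-linked lu)) (trans eq (head-linked (trans (sym lu≡lw) lu)))
    by-cases false ¬lu =
      σ⁻¹-injective (trans (sym (head-unlinked ¬lu)) (trans eq (head-unlinked (trans (sym lu≡lw) ¬lu))))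

  head-cliques : LabelClassesAreCliques G head
  head-cliques u w eq u≢w = by-cases (linked u) (linked w) refl refl
    where
    by-cases : ∀ p q → linked u ≡ p → linked w ≡ q → adj G u w ≡ true
    by-cases true true lu lw = ⊥-elim (u≢w (head-linked-injective eq (trans lu (sym lw))))
    by-cases false false ¬lu ¬lw = ⊥-elim (u≢w (head-linked-injective eq (trans ¬lu (sym ¬lw))))
    by-cases true false lu ¬lw = subst (λ z → adj G u z ≡ true) σu≡w lu
      where
      σu≡w : σ u ≡ w
      σu≡w = trans (cong σ (trans (sym (head-linked lu)) (trans eq (head-unlinked ¬lw)))) (σσ⁻¹ w)
    by-cases false true ¬lu lw = trans (adj-sym G u w) (subst (λ z → adj G w z ≡ true) σw≡u lw)
      where
      σw≡u : σ w ≡ u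
      σw≡u = trans (cong σ (trans (sym (head-linked lw)) (trans (sym eq) (head-unlinked ¬lu)))) (σσ⁻¹ u)

  head-adjacent : LabelClassesAreAdjacent G head
  head-adjacent u w ne with adj G (head u) (head w) in e
  ... | true  = head u , head w , head-idem u , head-idem w , e
  ... | false = σ (head u) , σ (head w) , head-σ-Head (head-Head u) , head-σ-Head (head-Head w) ,
                trans (σ-flips ne) (cong not e)

  head-factors⇒≤ : ∀ {K} (b : Fin M → Fin K) (h : Fin K → Fin M) →
                   (∀ x → head x ≡ h (b x)) → M ≤ K * 2
  head-factors⇒≤ b h factors = tagged-injective⇒≤ b side injective
    where
    side : Fin M → Fin 2
    side = Inverse.from 2↔Bool ∘ linked
    same-linked : ∀ {u w} → side u ≡ side w → linked u ≡ linked w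
    same-linked {u} {w} e = trans (sym (Inverse.strictlyInverseˡ 2↔Bool (linked u)))
      (trans (cong (Inverse.to 2↔Bool) e) (Inverse.strictlyInverseˡ 2↔Bool (linked w)))
    injective : ∀ {u w} → b u ≡ b w → side u ≡ side w → u ≡ w
    injective {u} {w} e e′ =
      head-linked-injective (trans (factors u) (trans (cong h e) (sym (factors w)))) (same-linked e′)

half-≤ : ∀ n K → suc (4 * n) ≤ K * 2 → suc (2 * n) ≤ K
half-≤ n K 4n<2K = *-cancelˡ-< 2 (2 * n) K (subst₂ _<_ (*-assoc 2 2 n) (*-comm K 2) 4n<2K)

lemma8 : (n : ℕ) (G : Graph (suc (4 * n))) →
         SelfComplementary G → HasCompleteMinor (suc (2 * n)) G
lemma8 n G G≅cG =
  ≼-contractLabelClasses _≟_ (suc (2 * n)) G head head-cliques head-adjacent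
    (λ b h factors → half-≤ n _ (head-factors⇒≤ b h factors))
  where open SelfComplementaryPairing G G≅cG
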